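{- Let $q$ be a prime power, $n\ge1$, and let $F\in\mathbb{F}_{q^n}[x]$ satisfy $F^q\equiv F\pmod{x^{q^n}-x}$ and $\deg F\le q^n-1$. Then $F$ can be written as $F=\sum_{i=1}^eF_i$, where $F_i=\sum_{m\in O_{m_i}}m$ for certain monomials $m_1,\ldots,m_e$ of $F$. Moreover, for each $1\le i\le e$, $F_i$ is defined over $\mathbb F_{q^{s(m_i)}}$.
   Context: For a generator $g$ of $\operatorname{Gal}(\mathbb{F}_{q^n}|\mathbb{F}_q)$, the rule $g^j(m)=m^{q^j}\bmod(x^{q^n}-x)$ defines an action of this Galois group on the set of monomials (nonzero terms) of $F$; $O_m$ denotes the orbit of the monomial $m$ under this action and $s(m)=|O_m|$. $P\bmod(x^{q^n}-x)$ is the remainder on division by $x^{q^n}-x$. -}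

module Defs where

open import Level using (Level; _⊔_) renaming (suc to lsuc)
open import Algebra.Bundles using (CommutativeRing)
open import Data.Nat as ℕ using (ℕ; zero; suc; _<?_; _≤_)
open import Data.Nat.DivMod using (_%_)
open import Data.Nat.Primality using (Prime)
open import Data.Fin using (Fin; toℕ)
open import Data.List using (List; []; _∷_; map; foldr; deduplicate; length; upTo)
open import Data.Product using (Σ; ∃; _×_; _,_)
open import Relation.Nullary using (¬_; yes; no; Dec)
open import Relation.Nullary.Decidable using (_×-dec_)
open import Relation.Binary using (Decidable)
open import Relation.Binary.PropositionalEquality using (_≡_)

IsPrimePower : ℕ → Set
IsPrimePower q = Σ ℕ λ p → Σ ℕ λ k → Prime p × q ≡ p ℕ.^ suc k

record FiniteField (c ℓ : Level) (N : ℕ) : Set (lsuc (c ⊔ ℓ)) where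
  field
    commRing : CommutativeRing c ℓ
  open CommutativeRing commRing public
  field
    _≟_      : Decidable _≈_
    1≉0      : ¬ (1# ≈ 0#)
    inverse  : ∀ x → ¬ (x ≈ 0#) → Σ Carrier λ y → (x * y) ≈ 1#
    enum     : Fin N → Carrier
    enum-inj : ∀ i j → enum i ≈ enum j → i ≡ j
    enum-surj : ∀ x → Σ (Fin N) λ i → enum i ≈ x

-- Reduction of the exponent of x^e modulo x^N - x:
-- x^e mod (x^N - x) = x^(redExp N e).
redExp : ℕ → ℕ → ℕ
redExp zero e = e
redExp (suc zero) e = e
redExp (suc (suc k)) e with e <? suc (suc k)
... | yes _ = e
... | no _ = suc ((e ℕ.∸ 1) % suc k)

module FFOps {c ℓ : Level} (q n : ℕ) (K : FiniteField c ℓ (q ℕ.^ n)) where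
  open FiniteField K

  N : ℕ
  N = q ℕ.^ n

  pow : Carrier → ℕ → Carrier
  pow x zero = 1#
  pow x (suc k) = x * pow x k

  ΣFin : (m : ℕ) → (Fin m → Carrier) → Carrier
  ΣFin zero f = 0#
  ΣFin (suc m) f = f Fin.zero + ΣFin m (λ i → f (Fin.suc i))

  -- Polynomials in F_{q^n}[x] of degree ≤ q^n - 1, as coefficient vectors:
  -- F k is the coefficient of x^k.
  Poly : Set c
  Poly = Fin N → Carrier

  _≈P_ : Poly → Poly → Set ℓ
  F ≈P G = ∀ k → F k ≈ G k

  0P : Poly
  0P _ = 0#

  1P : Poly
  1P k with toℕ k ℕ.≟ 0
  ... | yes _ = 1#
  ... | no _ = 0#

  _+P_ : Poly → Poly → Poly
  (F +P G) k = F k + G k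

  _*P_ : Poly → Poly → Poly
  (F *P G) k = ΣFin N λ i → ΣFin N λ j →
    cond (redExp N (toℕ i ℕ.+ toℕ j) ℕ.≟ toℕ k) (F i * G j)
    where
      cond : ∀ {P : Set} → Dec P → Carrier → Carrier
      cond (yes _) x = x
      cond (no _) _ = 0#

  powP : Poly → ℕ → Poly
  powP F zero = 1P
  powP F (suc k) = F *P powP F k

  record Monomial : Set (c ⊔ ℓ) where
    constructor mono
    field
      coef : Carrier
      expo : ℕ
      coef≉0 : ¬ (coef ≈ 0#)

  MonomialOf : Poly → Monomial → Set ℓ
  MonomialOf F m = Σ (Fin N) λ k → toℕ k ≡ Monomial.expo m × Monomial.coef m ≈ F k

  monoPoly : Monomial → Poly
  monoPoly m k with toℕ k ℕ.≟ Monomial.expo m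
  ... | yes _ = Monomial.coef m
  ... | no _ = 0#

  _≈M_ : Monomial → Monomial → Set ℓ
  m ≈M m' = (Monomial.coef m ≈ Monomial.coef m') × (Monomial.expo m ≡ Monomial.expo m')

  _≟M_ : Decidable _≈M_
  m ≟M m' = (Monomial.coef m ≟ Monomial.coef m') ×-dec (Monomial.expo m ℕ.≟ Monomial.expo m')

  -- The action of the generator g = Frobenius of Gal(F_{q^n}|F_q):
  -- g^j(m) = m^(q^j) mod (x^N - x)
  powNonzero : ∀ x k → ¬ (x ≈ 0#) → ¬ (pow x k ≈ 0#)
  powNonzero x zero _ h = 1≉0 h
  powNonzero x (suc k) x≉0 h with inverse x x≉0
  ... | y , xy≈1 = powNonzero x k x≉0 (begin
        pow x k                 ≈⟨ sym (*-identityˡ _) ⟩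
        1# * pow x k            ≈⟨ *-congʳ (sym xy≈1) ⟩
        (x * y) * pow x k       ≈⟨ *-congʳ (*-comm x y) ⟩
        (y * x) * pow x k       ≈⟨ *-assoc y x (pow x k) ⟩
        y * (x * pow x k)       ≈⟨ *-congˡ h ⟩
        y * 0#                  ≈⟨ zeroʳ y ⟩
        0# ∎)
    where open import Relation.Binary.Reasoning.Setoid setoid

  act : ℕ → Monomial → Monomial
  act j (mono a e a≉0) =
    mono (pow a (q ℕ.^ j)) (redExp N (e ℕ.* q ℕ.^ j)) (powNonzero a (q ℕ.^ j) a≉0)

  orbit : Monomial → List Monomial
  orbit m = deduplicate _≟M_ (map (λ j → act j m) (upTo n))

  s : Monomial → ℕ
  s m = length (orbit m)

  sumP : List Poly → Poly
  sumP = foldr _+P_ 0P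

  orbitSum : Monomial → Poly
  orbitSum m = sumP (map monoPoly (orbit m))

  -- P is defined over F_{q^t}: all its coefficients lie in the subfield
  -- F_{q^t} = { a : a^(q^t) = a }
  DefinedOver : ℕ → Poly → Set ℓ
  DefinedOver t P = ∀ k → pow (P k) (q ℕ.^ t) ≈ P k

-- Polynomials of degree < N = q^n modulo x^N − x form the monoid algebra of the exponents
-- {0, …, N − 1} under reduced addition. F_N has characteristic p (N·1 = 0 in its additive group,
-- and F_N has no nilpotents), so for the power q of p Frobenius gives F^q = Σ_e F_e^q x^(q·e),
-- where e ↦ q·e is injective because q^n·e = e. Hence F^q = F says F_(q·e) = F_e^q: along the
-- orbit e, q·e, q²·e, … the coefficients of F are those of the monomials g^j(m), and F is the sum
-- of the orbit sums of its monomials, removed one orbit at a time. The orbit of m has s(m)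
-- elements, the period of its exponent, so every coefficient c of its orbit sum has c^(q^s(m)) = c.
module Submission where

open import Defs
open import Level using (Level)
open import Data.Nat using (ℕ; _≤_)
open import Data.List using (List; map)
open import Data.List.Relation.Unary.All using (All)
open import Data.Product using (Σ; _×_)

open import Level using (0ℓ; _⊔_)
open import Algebra.Bundles using (CommutativeSemiring; CommutativeMonoid; AbelianGroup)
open import Algebra.Core using (Op₂)
open import Algebra.Structures using (IsCommutativeMonoid; IsCommutativeSemiring)
open import Algebra.Structures.Biased using (isCommutativeSemiringˡ)
import Algebra.Construct.Pointwise as Pointwise
open import Data.Nat as ℕ using (zero; suc; _<_; s≤s; z≤n; z<s; _!; _∸_)
import Data.Nat.Properties as ℕ
open import Data.Nat.Divisibility using (_∣_; divides; ∣-refl; ∣m⇒∣m*n; ∣⇒≤)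
open import Data.Nat.DivMod using (_%_; m/n*n≡m; m%n<n; m≡m%n+[m/n]*n)
open import Data.Nat.Primality using (Prime; euclidsLemma; prime⇒nonZero; prime⇒nonTrivial)
open import Data.Nat.Combinatorics using (_C_; nCk≡n!/k![n-k]!; k![n∸k]!∣n!; nCn≡1)
open import Data.Fin as Fin using (Fin; toℕ; fromℕ<)
open import Data.Fin.Properties
  using (toℕ-injective; toℕ-fromℕ<; toℕ<n; toℕ-inject₁; toℕ-fromℕ; suc-injective; injective⇒≤)
open import Data.Fin.Permutation using (Permutation′; permutation)
open import Data.List using ([]; _∷_; upTo; length; lookup; allFin)
open import Data.List.Relation.Unary.All as All using ([]; _∷_)
import Data.List.Relation.Unary.All.Properties as All
open import Data.List.Relation.Unary.Any as Any using (Any; here; there; index; any?)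
import Data.List.Relation.Unary.Any.Properties as Any
open import Data.List.Relation.Unary.AllPairs using ([]; _∷_)
open import Data.List.Relation.Unary.Unique.DecSetoid.Properties using (deduplicate-!)
open import Data.List.Membership.Propositional using (_∉_)
open import Data.List.Membership.Propositional.Properties using (∈-allFin) renaming (∈-lookup to ∈ₚ-lookup)
open import Data.Product using (_,_; proj₁; proj₂)
open import Data.Sum using (_⊎_; inj₁; inj₂)
open import Function using (_∘_; id)
open import Relation.Binary.Bundles using (Setoid; DecSetoid)
open import Relation.Binary.Definitions using (DecidableEquality)
import Relation.Binary.PropositionalEquality as ≡
open ≡ using (_≡_; _≢_)
open import Relation.Nullary using (¬_; Dec; yes; no; contradiction)
open import Algebra.Properties.CommutativeSemigroup ℕ.+-commutativeSemigroup using (x∙yz≈y∙xz)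

module _ where
  open import Data.Nat using (_+_; _*_; _<?_; _^_)
  open import Data.Nat.Properties using (+-suc; *-suc)
  open import Data.Nat.DivMod using (%-distribˡ-+; m%n%n≡m%n; [m+kn]%n≡m%n; m<n⇒m%n≡m)
  open ≡ using (refl; cong; sym; trans; subst; module ≡-Reasoning)

  private
    module Reduce (m : ℕ) where
      L : ℕ
      L = suc m

      reduce : ℕ → ℕ
      reduce zero    = zero
      reduce (suc d) = suc (d % L)

      redExp≡reduce : ∀ e → redExp (suc L) e ≡ reduce e
      redExp≡reduce zero = refl
      redExp≡reduce (suc d) with suc d <? suc L
      ... | yes (s≤s d<L) = cong suc (sym (m<n⇒m%n≡m d<L))
      ... | no _          = refl

      reduce-+ʳ : ∀ x y → reduce (x + reduce y) ≡ reduce (x + y)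
      reduce-+ʳ x zero    = refl
      reduce-+ʳ x (suc d) rewrite +-suc x (d % L) | +-suc x d = cong suc (begin
        (x + d % L) % L          ≡⟨ %-distribˡ-+ x (d % L) L ⟩
        (x % L + d % L % L) % L  ≡⟨ cong (λ r → (x % L + r) % L) (m%n%n≡m%n d L) ⟩
        (x % L + d % L) % L      ≡⟨ %-distribˡ-+ x d L ⟨
        (x + d) % L              ∎)
        where open ≡-Reasoning

      reduce-*-self : ∀ e → e < suc L → reduce (e * suc L) ≡ e
      reduce-*-self zero    _         = refl
      reduce-*-self (suc d) (s≤s d<L) = cong suc (begin
        (L + d * suc L) % L    ≡⟨ cong (λ r → (L + r) % L) (*-suc d L) ⟩
        (L + (d + d * L)) % L  ≡⟨ cong (_% L) (x∙yz≈y∙xz L d (d * L)) ⟩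
        (d + suc d * L) % L    ≡⟨ [m+kn]%n≡m%n d (suc d) L ⟩
        d % L                  ≡⟨ m<n⇒m%n≡m d<L ⟩
        d                      ∎)
        where open ≡-Reasoning

  redExp-< : ∀ {N} → 1 < N → ∀ e → redExp N e < N
  redExp-< {suc zero}    (s≤s ()) _
  redExp-< {suc (suc m)} _        zero    = s≤s z≤n
  redExp-< {suc (suc m)} _        (suc d) = subst (_< suc L) (sym (redExp≡reduce (suc d))) (s≤s (m%n<n d L))
    where open Reduce m

  redExp-id : ∀ {N e} → e < N → redExp N e ≡ e
  redExp-id {suc zero}        _   = refl
  redExp-id {suc (suc m)} {e} e<N with e <? suc (suc m)
  ... | yes _   = refl
  ... | no  e≮N = contradiction e<N e≮N

  redExp-+ʳ : ∀ N x y → redExp N (x + redExp N y) ≡ redExp N (x + y)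
  redExp-+ʳ zero          x y = refl
  redExp-+ʳ (suc zero)    x y = refl
  redExp-+ʳ (suc (suc m)) x y = begin
    redExp (suc L) (x + redExp (suc L) y)  ≡⟨ cong (λ r → redExp (suc L) (x + r)) (redExp≡reduce y) ⟩
    redExp (suc L) (x + reduce y)          ≡⟨ redExp≡reduce (x + reduce y) ⟩
    reduce (x + reduce y)                  ≡⟨ reduce-+ʳ x y ⟩
    reduce (x + y)                         ≡⟨ redExp≡reduce (x + y) ⟨
    redExp (suc L) (x + y)                 ∎
    where
    open Reduce m
    open ≡-Reasoning

  redExp-*-self : ∀ {N e} → e < N → redExp N (e * N) ≡ e
  redExp-*-self {suc zero}    (s≤s z≤n) = refl
  redExp-*-self {suc (suc m)} {e} e<N   = trans (redExp≡reduce (e * suc L)) (reduce-*-self e e<N)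
    where open Reduce m

  m∣m^n : ∀ {m n} → 0 < n → m ∣ m ^ n
  m∣m^n {m} {suc n} _ = ∣m⇒∣m*n (m ^ n) ∣-refl

module ExponentMonoid {N : ℕ} (1<N : 1 < N) where
  open import Data.Nat using (_+_; _*_)
  open ≡ using (refl; cong; cong₂; sym; trans; isEquivalence; module ≡-Reasoning)

  infixl 6 _⊕_
  _⊕_ : Fin N → Fin N → Fin N
  i ⊕ j = fromℕ< (redExp-< 1<N (toℕ i + toℕ j))

  𝟘 : Fin N
  𝟘 = fromℕ< (ℕ.<-trans z<s 1<N)

  toℕ-⊕ : ∀ i j → toℕ (i ⊕ j) ≡ redExp N (toℕ i + toℕ j)
  toℕ-⊕ i j = toℕ-fromℕ< _

  toℕ-𝟘 : toℕ 𝟘 ≡ 0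
  toℕ-𝟘 = toℕ-fromℕ< _

  ⊕-assoc : ∀ i j k → (i ⊕ j) ⊕ k ≡ i ⊕ (j ⊕ k)
  ⊕-assoc i j k = toℕ-injective (begin
    toℕ ((i ⊕ j) ⊕ k)                             ≡⟨ toℕ-⊕ (i ⊕ j) k ⟩
    redExp N (toℕ (i ⊕ j) + toℕ k)                ≡⟨ cong (λ e → redExp N (e + toℕ k)) (toℕ-⊕ i j) ⟩
    redExp N (redExp N (toℕ i + toℕ j) + toℕ k)   ≡⟨ cong (redExp N) (ℕ.+-comm _ (toℕ k)) ⟩
    redExp N (toℕ k + redExp N (toℕ i + toℕ j))   ≡⟨ redExp-+ʳ N (toℕ k) _ ⟩
    redExp N (toℕ k + (toℕ i + toℕ j))            ≡⟨ cong (redExp N) (x∙yz≈y∙xz (toℕ k) (toℕ i) (toℕ j)) ⟩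
    redExp N (toℕ i + (toℕ k + toℕ j))            ≡⟨ cong (λ e → redExp N (toℕ i + e)) (ℕ.+-comm (toℕ k) (toℕ j)) ⟩
    redExp N (toℕ i + (toℕ j + toℕ k))            ≡⟨ redExp-+ʳ N (toℕ i) _ ⟨
    redExp N (toℕ i + redExp N (toℕ j + toℕ k))   ≡⟨ cong (λ e → redExp N (toℕ i + e)) (toℕ-⊕ j k) ⟨
    redExp N (toℕ i + toℕ (j ⊕ k))                ≡⟨ toℕ-⊕ i (j ⊕ k) ⟨
    toℕ (i ⊕ (j ⊕ k))                             ∎)
    where open ≡-Reasoning

  ⊕-comm : ∀ i j → i ⊕ j ≡ j ⊕ i
  ⊕-comm i j = toℕ-injective (trans (toℕ-⊕ i j) (trans (cong (redExp N) (ℕ.+-comm (toℕ i) (toℕ j))) (sym (toℕ-⊕ j i))))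

  ⊕-identityˡ : ∀ i → 𝟘 ⊕ i ≡ i
  ⊕-identityˡ i = toℕ-injective (trans (toℕ-⊕ 𝟘 i)
    (trans (cong (λ e → redExp N (e + toℕ i)) toℕ-𝟘) (redExp-id (toℕ<n i))))

  ⊕-isCommutativeMonoid : IsCommutativeMonoid _≡_ _⊕_ 𝟘
  ⊕-isCommutativeMonoid = record
    { isMonoid = record
      { isSemigroup = record
        { isMagma = record { isEquivalence = isEquivalence ; ∙-cong = cong₂ _⊕_ }
        ; assoc   = ⊕-assoc }
      ; identity = ⊕-identityˡ , λ i → trans (⊕-comm i 𝟘) (⊕-identityˡ i) }
    ; comm = ⊕-comm }

  ⊕-commutativeMonoid : CommutativeMonoid 0ℓ 0ℓ
  ⊕-commutativeMonoid = record { isCommutativeMonoid = ⊕-isCommutativeMonoid }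

  open import Algebra.Definitions.RawMonoid (CommutativeMonoid.rawMonoid ⊕-commutativeMonoid) public
    using () renaming (_×_ to _×ᵢ_)
  open import Algebra.Properties.Monoid.Mult (CommutativeMonoid.monoid ⊕-commutativeMonoid) public
    using () renaming (×-homo-1 to ×ᵢ-homo-1; ×-assocˡ to ×ᵢ-assocˡ)

  toℕ-×ᵢ : ∀ k i → toℕ (k ×ᵢ i) ≡ redExp N (toℕ i * k)
  toℕ-×ᵢ zero    i = trans toℕ-𝟘 (sym (trans (cong (redExp N) (ℕ.*-zeroʳ (toℕ i))) (redExp-id (ℕ.<-trans z<s 1<N))))
  toℕ-×ᵢ (suc k) i = begin
    toℕ (i ⊕ k ×ᵢ i)                           ≡⟨ toℕ-⊕ i (k ×ᵢ i) ⟩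
    redExp N (toℕ i + toℕ (k ×ᵢ i))            ≡⟨ cong (λ e → redExp N (toℕ i + e)) (toℕ-×ᵢ k i) ⟩
    redExp N (toℕ i + redExp N (toℕ i * k))    ≡⟨ redExp-+ʳ N (toℕ i) _ ⟩
    redExp N (toℕ i + toℕ i * k)               ≡⟨ cong (redExp N) (ℕ.*-suc (toℕ i) k) ⟨
    redExp N (toℕ i * suc k)                   ∎
    where open ≡-Reasoning

  N×ᵢ-identity : ∀ i → N ×ᵢ i ≡ i
  N×ᵢ-identity i = toℕ-injective (trans (toℕ-×ᵢ N i) (redExp-*-self (toℕ<n i)))

  ×ᵢ-injective : ∀ {k} → k ∣ N → ∀ {i j} → k ×ᵢ i ≡ k ×ᵢ j → i ≡ j
  ×ᵢ-injective {k} (divides t N≡t*k) {i} {j} k×i≡k×j = begin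
    i              ≡⟨ N×ᵢ-identity i ⟨
    N ×ᵢ i         ≡⟨ cong (_×ᵢ i) N≡t*k ⟩
    (t * k) ×ᵢ i   ≡⟨ ×ᵢ-assocˡ i t k ⟨
    t ×ᵢ (k ×ᵢ i)  ≡⟨ cong (t ×ᵢ_) k×i≡k×j ⟩
    t ×ᵢ (k ×ᵢ j)  ≡⟨ ×ᵢ-assocˡ j t k ⟩
    (t * k) ×ᵢ j   ≡⟨ cong (_×ᵢ j) N≡t*k ⟨
    N ×ᵢ j         ≡⟨ N×ᵢ-identity j ⟩
    j              ∎
    where open ≡-Reasoning

prime∤! : ∀ {p m} → Prime p → m < p → ¬ p ∣ m !
prime∤! {p} {zero}  pr m<p p∣1 = contradiction (∣⇒≤ p∣1) (ℕ.<⇒≱ (ℕ.nonTrivial⇒n>1 p {{prime⇒nonTrivial pr}}))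
prime∤! {p} {suc m} pr m<p p∣m! with euclidsLemma (suc m) (m !) pr p∣m!
... | inj₁ p∣1+m = contradiction (∣⇒≤ p∣1+m) (ℕ.<⇒≱ m<p)
... | inj₂ p∣m!  = prime∤! pr (ℕ.<-trans (ℕ.n<1+n m) m<p) p∣m!

n∣n! : ∀ {n} → 0 < n → n ∣ n !
n∣n! {suc n} _ = ∣m⇒∣m*n (n !) ∣-refl

prime∣choose : ∀ {p k} → Prime p → 0 < k → k < p → p ∣ p C k
prime∣choose {p} {k} pr 0<k k<p with euclidsLemma (p C k) (k ! ℕ.* (p ∸ k) !) pr p∣product
  where
  instance
    k![p-k]!≢0 : ℕ.NonZero (k ! ℕ.* (p ∸ k) !)
    k![p-k]!≢0 = ℕ._!*_!≢0 k (p ∸ k)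
  p∣product : p ∣ (p C k) ℕ.* (k ! ℕ.* (p ∸ k) !)
  p∣product = ≡.subst (p ∣_) (≡.sym (≡.trans (≡.cong (ℕ._* (k ! ℕ.* (p ∸ k) !)) (nCk≡n!/k![n-k]! (ℕ.<⇒≤ k<p)))
                                              (m/n*n≡m (k![n∸k]!∣n! (ℕ.<⇒≤ k<p)))))
                      (n∣n! (ℕ.<-trans 0<k k<p))
... | inj₁ p∣C = p∣C
... | inj₂ p∣k![p-k]! with euclidsLemma (k !) ((p ∸ k) !) pr p∣k![p-k]!
...   | inj₁ p∣k!     = contradiction p∣k! (prime∤! pr k<p)
...   | inj₂ p∣[p-k]! = contradiction p∣[p-k]! (prime∤! pr (ℕ.∸-monoʳ-< 0<k (ℕ.<⇒≤ k<p)))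

module Frobenius {a ℓ} (S : CommutativeSemiring a ℓ) {p : ℕ} (pr : Prime p) where
  open CommutativeSemiring S
  open import Algebra.Properties.Semiring.Mult semiring using (×1-homo-*; ×-assoc-*) renaming (_×_ to _·_; ×-congʳ to ·-congʳ)
  open import Algebra.Properties.Semiring.Exp semiring using (_^_; ^-congˡ; ^-assocʳ)
  open import Algebra.Properties.Semiring.Sum semiring using (sum; sum-init-last; sum-cong-≋; sum-replicate-zero)
  open import Algebra.Properties.CommutativeSemiring.Binomial S using (theorem; binomialTerm)
  open import Relation.Binary.Reasoning.Setoid setoid

  module _ (char : p · 1# ≈ 0#) where

    multiple-of-char≈0 : ∀ {n} x → p ∣ n → n · x ≈ 0#
    multiple-of-char≈0 {n} x (divides t ≡.refl) = begin
      (t ℕ.* p) · x                ≈⟨ trans (×-assoc-* (t ℕ.* p) 1# x) (·-congʳ (t ℕ.* p) (*-identityˡ x)) ⟨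
      ((t ℕ.* p) · 1#) * x         ≈⟨ *-congʳ (×1-homo-* t p) ⟩
      ((t · 1#) * (p · 1#)) * x    ≈⟨ *-congʳ (*-congˡ char) ⟩
      ((t · 1#) * 0#) * x          ≈⟨ trans (*-congʳ (zeroʳ _)) (zeroˡ x) ⟩
      0#                           ∎

    private
      binomial-char : ∀ n → suc n ≡ p → ∀ x y → (x + y) ^ suc n ≈ x ^ suc n + y ^ suc n
      binomial-char n 1+n≡p x y = begin
        (x + y) ^ suc n                                             ≈⟨ theorem (suc n) x y ⟩
        T Fin.zero + sum (T ∘ Fin.suc)                              ≈⟨ +-congˡ (sum-init-last (T ∘ Fin.suc)) ⟩
        T Fin.zero + (sum (T ∘ Fin.suc ∘ Fin.inject₁) + T (Fin.fromℕ (suc n)))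
          ≈⟨ +-congˡ (+-congʳ (trans (sum-cong-≋ interior≈0) (sum-replicate-zero n))) ⟩
        T Fin.zero + (0# + T (Fin.fromℕ (suc n)))                   ≈⟨ +-cong first (trans (+-identityˡ _) last) ⟩
        y ^ suc n + x ^ suc n                                       ≈⟨ +-comm _ _ ⟩
        x ^ suc n + y ^ suc n                                       ∎
        where
        T : Fin (suc (suc n)) → Carrier
        T = binomialTerm x y (suc n)
        interior≈0 : ∀ i → T (Fin.suc (Fin.inject₁ i)) ≈ 0#
        interior≈0 i = multiple-of-char≈0 _ (≡.subst (λ m → p ∣ m C k) (≡.sym 1+n≡p)
          (prime∣choose pr (s≤s z≤n) (≡.subst (k <_) 1+n≡p (s≤s k-1<n))))
          where
          k : ℕ
          k = suc (toℕ (Fin.inject₁ i))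
          k-1<n : toℕ (Fin.inject₁ i) < n
          k-1<n = ≡.subst (_< n) (≡.sym (toℕ-inject₁ i)) (toℕ<n i)
        first : T Fin.zero ≈ y ^ suc n
        first = trans (+-identityʳ _) (*-identityˡ _)
        last : T (Fin.fromℕ (suc n)) ≈ x ^ suc n
        last = begin
          (suc n C toℕ (Fin.fromℕ (suc n))) · ((x ^ toℕ (Fin.fromℕ (suc n))) * (y ^ (suc n ∸ toℕ (Fin.fromℕ (suc n)))))
            ≡⟨ ≡.cong (λ k → (suc n C k) · ((x ^ k) * (y ^ (suc n ∸ k)))) (toℕ-fromℕ (suc n)) ⟩
          (suc n C suc n) · ((x ^ suc n) * (y ^ (n ∸ n)))
            ≡⟨ ≡.cong₂ (λ c k → c · ((x ^ suc n) * (y ^ k))) (nCn≡1 (suc n)) (ℕ.n∸n≡0 n) ⟩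
          1 · ((x ^ suc n) * 1#)                                    ≈⟨ trans (+-identityʳ _) (*-identityʳ _) ⟩
          x ^ suc n                                                 ∎

    frobenius : ∀ x y → (x + y) ^ p ≈ x ^ p + y ^ p
    frobenius x y = ≡.subst (λ m → (x + y) ^ m ≈ x ^ m + y ^ m) 1+p-1≡p (binomial-char (p ∸ 1) 1+p-1≡p x y)
      where
      1+p-1≡p : suc (p ∸ 1) ≡ p
      1+p-1≡p = ℕ.suc-pred p {{prime⇒nonZero pr}}

    frobenius-^ : ∀ m x y → (x + y) ^ (p ℕ.^ m) ≈ x ^ (p ℕ.^ m) + y ^ (p ℕ.^ m)
    frobenius-^ zero    x y = trans (*-identityʳ _) (sym (+-cong (*-identityʳ x) (*-identityʳ y)))
    frobenius-^ (suc m) x y = begin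
      (x + y) ^ (p ℕ.* p ℕ.^ m)                  ≈⟨ ^-assocʳ (x + y) p (p ℕ.^ m) ⟨
      ((x + y) ^ p) ^ (p ℕ.^ m)                  ≈⟨ ^-congˡ (p ℕ.^ m) (frobenius x y) ⟩
      (x ^ p + y ^ p) ^ (p ℕ.^ m)                ≈⟨ frobenius-^ m (x ^ p) (y ^ p) ⟩
      (x ^ p) ^ (p ℕ.^ m) + (y ^ p) ^ (p ℕ.^ m)  ≈⟨ +-cong (^-assocʳ x p (p ℕ.^ m)) (^-assocʳ y p (p ℕ.^ m)) ⟩
      x ^ (p ℕ.* p ℕ.^ m) + y ^ (p ℕ.* p ℕ.^ m)  ∎

    frobenius-sum : ∀ m {n} (f : Fin n → Carrier) → sum f ^ (p ℕ.^ m) ≈ sum (λ i → f i ^ (p ℕ.^ m))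
    frobenius-sum m {zero}  f =
      ≡.subst (λ e → 0# ^ e ≈ 0#) (ℕ.suc-pred (p ℕ.^ m) {{ℕ.m^n≢0 p m {{prime⇒nonZero pr}}}}) (zeroˡ _)
    frobenius-sum m {suc n} f = trans (frobenius-^ m (f Fin.zero) (sum (f ∘ Fin.suc))) (+-congˡ (frobenius-sum m (f ∘ Fin.suc)))

module MonoidAlgebra {c ℓ} (S : CommutativeSemiring c ℓ) {N : ℕ}
                     {_∙_ : Op₂ (Fin N)} {ε : Fin N} (M : IsCommutativeMonoid _≡_ _∙_ ε) where

  open CommutativeSemiring S
  open import Algebra.Properties.Semiring.Sum semiring
  open import Relation.Binary.Reasoning.Setoid setoid
  private module M = IsCommutativeMonoid M

  Element : Set c
  Element = Fin N → Carrier

  infix 4 _≋_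
  _≋_ : Element → Element → Set ℓ
  F ≋ G = ∀ k → F k ≈ G k

  single : Fin N → Carrier → Element
  single i a k with i Fin.≟ k
  ... | yes _ = a
  ... | no  _ = 0#

  single-self : ∀ i a → single i a i ≈ a
  single-self i a with i Fin.≟ i
  ... | yes _   = refl
  ... | no i≢i  = contradiction ≡.refl i≢i

  single-other : ∀ {i k} a → i ≢ k → single i a k ≈ 0#
  single-other {i} {k} a i≢k with i Fin.≟ k
  ... | yes i≡k = contradiction i≡k i≢k
  ... | no  _   = refl

  single-sym : ∀ i k a → single i a k ≈ single k a i
  single-sym i k a with i Fin.≟ k | k Fin.≟ i
  ... | yes _   | yes _   = refl
  ... | no  _   | no  _   = refl
  ... | yes i≡k | no  k≢i = contradiction (≡.sym i≡k) k≢i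
  ... | no  i≢k | yes k≡i = contradiction (≡.sym k≡i) i≢k

  single-cong : ∀ i k {a b} → a ≈ b → single i a k ≈ single i b k
  single-cong i k a≈b with i Fin.≟ k
  ... | yes _ = a≈b
  ... | no  _ = refl

  single-zero : ∀ i k → single i 0# k ≈ 0#
  single-zero i k with i Fin.≟ k
  ... | yes _ = refl
  ... | no  _ = refl

  single-+ : ∀ i k a b → single i (a + b) k ≈ single i a k + single i b k
  single-+ i k a b with i Fin.≟ k
  ... | yes _ = refl
  ... | no  _ = sym (+-identityʳ 0#)

  single-*ʳ : ∀ i k a b → single i a k * b ≈ single i (a * b) k
  single-*ʳ i k a b with i Fin.≟ k
  ... | yes _ = refl
  ... | no  _ = zeroˡ b

  single-sum : ∀ i k {m} (f : Fin m → Carrier) → single i (sum f) k ≈ ∑[ j < m ] single i (f j) k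
  single-sum i k {m} f with i Fin.≟ k
  ... | yes _ = refl
  ... | no  _ = sym (sum-replicate-zero m)

  single-comm : ∀ i k j l a → single i (single j a l) k ≈ single j (single i a k) l
  single-comm i k j l a with i Fin.≟ k | j Fin.≟ l
  ... | yes _ | yes _ = refl
  ... | yes _ | no  _ = refl
  ... | no  _ | yes _ = refl
  ... | no  _ | no  _ = refl

  sum-supported-at : ∀ {m} (f : Fin m → Carrier) i → (∀ j → j ≢ i → f j ≈ 0#) → sum f ≈ f i
  sum-supported-at {suc m} f Fin.zero vanish = begin
    f Fin.zero + ∑[ j < m ] f (Fin.suc j)  ≈⟨ +-congˡ (sum-cong-≋ (λ j → vanish (Fin.suc j) λ ())) ⟩
    f Fin.zero + ∑[ j < m ] 0#             ≈⟨ +-congˡ (sum-replicate-zero m) ⟩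
    f Fin.zero + 0#                        ≈⟨ +-identityʳ _ ⟩
    f Fin.zero                             ∎
  sum-supported-at {suc m} f (Fin.suc i) vanish = begin
    f Fin.zero + ∑[ j < m ] f (Fin.suc j)  ≈⟨ +-cong (vanish Fin.zero λ ()) (sum-supported-at (λ j → f (Fin.suc j)) i
                                                 (λ j j≢i → vanish (Fin.suc j) (j≢i ∘ suc-injective))) ⟩
    0# + f (Fin.suc i)                     ≈⟨ +-identityˡ _ ⟩
    f (Fin.suc i)                          ∎

  sum-single : ∀ i (f : Fin N → Carrier) → ∑[ l < N ] single i (f l) l ≈ f i
  sum-single i f = trans (sum-supported-at _ i (λ j j≢i → single-other (f j) (j≢i ∘ ≡.sym)))
                         (single-self i (f i))

  single-expansion : ∀ F k → ∑[ i < N ] single i (F i) k ≈ F k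
  single-expansion F k = trans (sum-cong-≋ (λ i → single-sym i k (F i))) (sum-single k F)

  infixl 7 _⋆_
  _⋆_ : Element → Element → Element
  (F ⋆ G) k = ∑[ i < N ] ∑[ j < N ] single (i ∙ j) (F i * G j) k

  unit : Element
  unit = single ε 1#

  single-⋆ : ∀ a c H k → (single a c ⋆ H) k ≈ ∑[ j < N ] single (a ∙ j) (c * H j) k
  single-⋆ a c H k = begin
    ∑[ i < N ] ∑[ j < N ] single (i ∙ j) (single a c i * H j) k
      ≈⟨ sum-cong-≋ (λ i → sum-cong-≋ (λ j → trans (single-cong (i ∙ j) k (single-*ʳ a i c (H j)))
                                                    (single-comm (i ∙ j) k a i (c * H j)))) ⟩
    ∑[ i < N ] ∑[ j < N ] single a (single (i ∙ j) (c * H j) k) i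
      ≈⟨ sum-cong-≋ (λ i → sym (single-sum a i (λ j → single (i ∙ j) (c * H j) k))) ⟩
    ∑[ i < N ] single a (∑[ j < N ] single (i ∙ j) (c * H j) k) i
      ≈⟨ sum-single a (λ i → ∑[ j < N ] single (i ∙ j) (c * H j) k) ⟩
    ∑[ j < N ] single (a ∙ j) (c * H j) k ∎

  single-⋆-single : ∀ a b c d k → (single a c ⋆ single b d) k ≈ single (a ∙ b) (c * d) k
  single-⋆-single a b c d k = begin
    (single a c ⋆ single b d) k                        ≈⟨ single-⋆ a c (single b d) k ⟩
    ∑[ j < N ] single (a ∙ j) (c * single b d j) k
      ≈⟨ sum-cong-≋ (λ j → single-cong (a ∙ j) k (trans (*-comm c _) (single-*ʳ b j d c))) ⟩
    ∑[ j < N ] single (a ∙ j) (single b (d * c) j) k   ≈⟨ sum-cong-≋ (λ j → single-comm (a ∙ j) k b j (d * c)) ⟩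
    ∑[ j < N ] single b (single (a ∙ j) (d * c) k) j   ≈⟨ sum-single b (λ j → single (a ∙ j) (d * c) k) ⟩
    single (a ∙ b) (d * c) k                           ≈⟨ single-cong (a ∙ b) k (*-comm d c) ⟩
    single (a ∙ b) (c * d) k                           ∎

  ⋆-cong : ∀ {F F′ G G′} → F ≋ F′ → G ≋ G′ → F ⋆ G ≋ F′ ⋆ G′
  ⋆-cong F≋F′ G≋G′ k =
    sum-cong-≋ (λ i → sum-cong-≋ (λ j → single-cong (i ∙ j) k (*-cong (F≋F′ i) (G≋G′ j))))

  ⋆-comm : ∀ F G → F ⋆ G ≋ G ⋆ F
  ⋆-comm F G k = trans (∑-comm (λ i j → single (i ∙ j) (F i * G j) k)) (sum-cong-≋ (λ j → sum-cong-≋ (λ i →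
    trans (reflexive (≡.cong (λ x → single x (F i * G j) k) (M.comm i j)))
          (single-cong (j ∙ i) k (*-comm (F i) (G j))))))

  ⋆-zeroˡ : ∀ G → (λ _ → 0#) ⋆ G ≋ (λ _ → 0#)
  ⋆-zeroˡ G k = trans (sum-cong-≋ λ i → trans (sum-cong-≋ λ j → term≈0 i j) (sum-replicate-zero N)) (sum-replicate-zero N)
    where
    term≈0 : ∀ i j → single (i ∙ j) (0# * G j) k ≈ 0#
    term≈0 i j = trans (single-cong (i ∙ j) k (zeroˡ (G j))) (single-zero (i ∙ j) k)

  ⋆-distribʳ : ∀ H F G → (λ k → F k + G k) ⋆ H ≋ (λ k → (F ⋆ H) k + (G ⋆ H) k)
  ⋆-distribʳ H F G k = trans (sum-cong-≋ (λ i → trans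
      (sum-cong-≋ (λ j → trans (single-cong (i ∙ j) k (distribʳ (H j) (F i) (G i))) (single-+ (i ∙ j) k _ _)))
      (∑-distrib-+ (λ j → single (i ∙ j) (F i * H j) k) (λ j → single (i ∙ j) (G i * H j) k))))
    (∑-distrib-+ (λ i → ∑[ j < N ] single (i ∙ j) (F i * H j) k) (λ i → ∑[ j < N ] single (i ∙ j) (G i * H j) k))

  ⋆-identityˡ : ∀ G → unit ⋆ G ≋ G
  ⋆-identityˡ G k = begin
    (unit ⋆ G) k                            ≈⟨ single-⋆ ε 1# G k ⟩
    ∑[ j < N ] single (ε ∙ j) (1# * G j) k
      ≈⟨ sum-cong-≋ (λ j → trans (reflexive (≡.cong (λ x → single x _ k) (M.identityˡ j)))
                                 (single-cong j k (*-identityˡ (G j)))) ⟩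
    ∑[ j < N ] single j (G j) k             ≈⟨ single-expansion G k ⟩
    G k                                     ∎

  ∑ᵉ : ∀ {m} → (Fin m → Element) → Element
  ∑ᵉ {m} u k = ∑[ i < m ] u i k

  ⋆-sumˡ : ∀ {m} (u : Fin m → Element) H → ∑ᵉ u ⋆ H ≋ ∑ᵉ (λ i → u i ⋆ H)
  ⋆-sumˡ {zero}  u H = ⋆-zeroˡ H
  ⋆-sumˡ {suc m} u H k = trans (⋆-distribʳ H (u Fin.zero) (∑ᵉ (u ∘ Fin.suc)) k)
                               (+-congˡ (⋆-sumˡ (u ∘ Fin.suc) H k))

  ⋆-assoc-expand : ∀ F G H k →
    ((F ⋆ G) ⋆ H) k ≈ ∑[ i < N ] ∑[ j < N ] ∑[ h < N ] single ((i ∙ j) ∙ h) ((F i * G j) * H h) k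
  ⋆-assoc-expand F G H k = begin
    ((F ⋆ G) ⋆ H) k
      ≈⟨ ⋆-sumˡ (λ i → ∑ᵉ (λ j → single (i ∙ j) (F i * G j))) H k ⟩
    ∑[ i < N ] (∑ᵉ (λ j → single (i ∙ j) (F i * G j)) ⋆ H) k
      ≈⟨ sum-cong-≋ (λ i → ⋆-sumˡ (λ j → single (i ∙ j) (F i * G j)) H k) ⟩
    ∑[ i < N ] ∑[ j < N ] (single (i ∙ j) (F i * G j) ⋆ H) k
      ≈⟨ sum-cong-≋ (λ i → sum-cong-≋ (λ j → single-⋆ (i ∙ j) (F i * G j) H k)) ⟩
    ∑[ i < N ] ∑[ j < N ] ∑[ h < N ] single ((i ∙ j) ∙ h) ((F i * G j) * H h) k ∎

  ⋆-assoc : ∀ F G H → (F ⋆ G) ⋆ H ≋ F ⋆ (G ⋆ H)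
  ⋆-assoc F G H k = begin
    ((F ⋆ G) ⋆ H) k
      ≈⟨ ⋆-assoc-expand F G H k ⟩
    ∑[ i < N ] ∑[ j < N ] ∑[ h < N ] single ((i ∙ j) ∙ h) ((F i * G j) * H h) k
      ≈⟨ ∑-comm (λ i j → ∑[ h < N ] single ((i ∙ j) ∙ h) ((F i * G j) * H h) k) ⟩
    ∑[ j < N ] ∑[ i < N ] ∑[ h < N ] single ((i ∙ j) ∙ h) ((F i * G j) * H h) k
      ≈⟨ sum-cong-≋ (λ j → ∑-comm (λ i h → single ((i ∙ j) ∙ h) ((F i * G j) * H h) k)) ⟩
    ∑[ j < N ] ∑[ h < N ] ∑[ i < N ] single ((i ∙ j) ∙ h) ((F i * G j) * H h) k
      ≈⟨ sum-cong-≋ (λ j → sum-cong-≋ (λ h → sum-cong-≋ (λ i → rotate i j h))) ⟩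
    ∑[ j < N ] ∑[ h < N ] ∑[ i < N ] single ((j ∙ h) ∙ i) ((G j * H h) * F i) k
      ≈⟨ ⋆-assoc-expand G H F k ⟨
    ((G ⋆ H) ⋆ F) k
      ≈⟨ ⋆-comm (G ⋆ H) F k ⟩
    (F ⋆ (G ⋆ H)) k ∎
    where
    rotate : ∀ i j h → single ((i ∙ j) ∙ h) ((F i * G j) * H h) k ≈ single ((j ∙ h) ∙ i) ((G j * H h) * F i) k
    rotate i j h = trans (reflexive (≡.cong (λ x → single x _ k) (≡.trans (M.assoc i j h) (M.comm i (j ∙ h)))))
                         (single-cong ((j ∙ h) ∙ i) k (trans (*-assoc (F i) (G j) (H h)) (*-comm (F i) (G j * H h))))

  ⋆-isCommutativeSemiring : IsCommutativeSemiring _≋_ (λ F G k → F k + G k) _⋆_ (λ _ → 0#) unit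
  ⋆-isCommutativeSemiring = isCommutativeSemiringˡ record
    { +-isCommutativeMonoid = Pointwise.isCommutativeMonoid (Fin N) +-isCommutativeMonoid
    ; *-isCommutativeMonoid = record
      { isMonoid = record
        { isSemigroup = record
          { isMagma = record { isEquivalence = Pointwise.isEquivalence (Fin N) isEquivalence ; ∙-cong = ⋆-cong }
          ; assoc = ⋆-assoc }
        ; identity = ⋆-identityˡ , λ G k → trans (⋆-comm G unit k) (⋆-identityˡ G k) }
      ; comm = ⋆-comm }
    ; distribʳ = ⋆-distribʳ
    ; zeroˡ = ⋆-zeroˡ }

  algebra : CommutativeSemiring c ℓ
  algebra = record { isCommutativeSemiring = ⋆-isCommutativeSemiring }

  private
    index-monoid : CommutativeMonoid 0ℓ 0ℓ
    index-monoid = record { isCommutativeMonoid = M }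
  open import Algebra.Definitions.RawMonoid (CommutativeMonoid.rawMonoid index-monoid) using () renaming (_×_ to _×ᵢ_)

  open CommutativeSemiring algebra using () renaming (semiring to algebra-semiring)
  open import Algebra.Properties.Semiring.Exp algebra-semiring using () renaming (_^_ to _^ᴬ_; ^-congˡ to ^ᴬ-congˡ)
  open import Algebra.Properties.Semiring.Mult algebra-semiring using () renaming (_×_ to _·ᴬ_)
  open import Algebra.Properties.Semiring.Sum algebra-semiring using () renaming (sum to sumᴬ)
  open import Algebra.Properties.Semiring.Exp semiring using (_^_)
  open import Algebra.Properties.Semiring.Mult semiring using (×-assoc-*) renaming (_×_ to _·_; ×-congʳ to ·-congʳ)

  single-^ : ∀ i a m → single i a ^ᴬ m ≋ single (m ×ᵢ i) (a ^ m)
  single-^ i a zero    k = refl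
  single-^ i a (suc m) k = trans (⋆-cong (λ _ → refl) (single-^ i a m) k) (single-⋆-single i (m ×ᵢ i) a (a ^ m) k)

  sumᴬ-apply : ∀ {m} (u : Fin m → Element) k → sumᴬ u k ≡ ∑[ i < m ] u i k
  sumᴬ-apply {zero}  u k = ≡.refl
  sumᴬ-apply {suc m} u k = ≡.cong (u Fin.zero k +_) (sumᴬ-apply (u ∘ Fin.suc) k)

  ·ᴬ-apply : ∀ m F k → (m ·ᴬ F) k ≡ m · F k
  ·ᴬ-apply zero    F k = ≡.refl
  ·ᴬ-apply (suc m) F k = ≡.cong (F k +_) (·ᴬ-apply m F k)

  sum-single-injective : ∀ {f : Fin N → Fin N} → (∀ {i j} → f i ≡ f j → i ≡ j) →
                         ∀ (g : Fin N → Carrier) e → ∑[ i < N ] single (f i) (g i) (f e) ≈ g e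
  sum-single-injective {f} f-inj g e = trans (sum-supported-at _ e (λ i i≢e → single-other (g i) (i≢e ∘ f-inj)))
                                         (single-self (f e) (g e))

  module _ {p : ℕ} (pr : Prime p) (char : p · 1# ≈ 0#) where

    algebra-char : p ·ᴬ unit ≋ (λ _ → 0#)
    algebra-char k = begin
      (p ·ᴬ unit) k        ≡⟨ ·ᴬ-apply p unit k ⟩
      p · unit k           ≈⟨ ·-congʳ p (*-identityˡ (unit k)) ⟨
      p · (1# * unit k)    ≈⟨ ×-assoc-* p 1# (unit k) ⟨
      (p · 1#) * unit k    ≈⟨ trans (*-congʳ char) (zeroˡ _) ⟩
      0#                   ∎

    ^-char-power : ∀ m F → F ^ᴬ (p ℕ.^ m) ≋ ∑ᵉ (λ i → single ((p ℕ.^ m) ×ᵢ i) (F i ^ (p ℕ.^ m)))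
    ^-char-power m F k = begin
      (F ^ᴬ q) k                                    ≈⟨ ^ᴬ-congˡ q F≋sum k ⟩
      (sumᴬ (λ i → single i (F i)) ^ᴬ q) k          ≈⟨ frobenius-sum algebra-char m (λ i → single i (F i)) k ⟩
      sumᴬ (λ i → single i (F i) ^ᴬ q) k            ≡⟨ sumᴬ-apply (λ i → single i (F i) ^ᴬ q) k ⟩
      ∑[ i < N ] (single i (F i) ^ᴬ q) k            ≈⟨ sum-cong-≋ (λ i → single-^ i (F i) q k) ⟩
      ∑[ i < N ] single (q ×ᵢ i) (F i ^ q) k        ∎
      where
      open Frobenius algebra pr using (frobenius-sum)
      q : ℕ
      q = p ℕ.^ m
      F≋sum : F ≋ sumᴬ (λ i → single i (F i))
      F≋sum k = sym (trans (reflexive (sumᴬ-apply (λ i → single i (F i)) k)) (single-expansion F k))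

module _ {a ℓ} (G : AbelianGroup a ℓ) where
  open AbelianGroup G
  open import Algebra.Properties.CommutativeMonoid.Sum commutativeMonoid
  open import Algebra.Definitions.RawMonoid rawMonoid using () renaming (_×_ to _·_)
  open import Algebra.Properties.AbelianGroup G using (identityʳ-unique)
  open import Relation.Binary.Reasoning.Setoid setoid

  module _ {N : ℕ} (enum : Fin N → Carrier) (enum-injective : ∀ i j → enum i ≈ enum j → i ≡ j)
           (enum-surjective : ∀ x → Σ (Fin N) λ i → enum i ≈ x) where

    order-annihilates : ∀ x → N · x ≈ ε
    order-annihilates x = identityʳ-unique (sum enum) (N · x) (begin
      sum enum ∙ N · x                       ≈⟨ ∙-congˡ (sum-replicate N) ⟨
      sum enum ∙ sum {N} (λ _ → x)           ≈⟨ ∑-distrib-+ enum (λ _ → x) ⟨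
      sum (λ i → enum i ∙ x)                 ≈⟨ sum-cong-≋ (λ i → proj₂ (enum-surjective (enum i ∙ x))) ⟨
      sum (λ i → enum (translate x i))       ≈⟨ sum-permute enum translation ⟨
      sum enum                               ∎)
      where
      translate : Carrier → Fin N → Fin N
      translate y i = proj₁ (enum-surjective (enum i ∙ y))
      translate-inverse : ∀ y z → y ∙ z ≈ ε → ∀ i → translate z (translate y i) ≡ i
      translate-inverse y z y∙z≈ε i = enum-injective _ i (begin
        enum (translate z (translate y i))  ≈⟨ proj₂ (enum-surjective _) ⟩
        enum (translate y i) ∙ z            ≈⟨ ∙-congʳ (proj₂ (enum-surjective _)) ⟩
        (enum i ∙ y) ∙ z                    ≈⟨ assoc _ _ _ ⟩
        enum i ∙ (y ∙ z)                    ≈⟨ ∙-congˡ y∙z≈ε ⟩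
        enum i ∙ ε                          ≈⟨ identityʳ _ ⟩
        enum i                              ∎)
      translation : Permutation′ N
      translation = permutation (translate x) (translate (x ⁻¹))
                                (translate-inverse (x ⁻¹) x (inverseˡ x)) (translate-inverse x (x ⁻¹) (inverseʳ x))

module Iteration {a} {A : Set a} (_≟_ : DecidableEquality A) (f : A → A)
                 (f-injective : ∀ {x y} → f x ≡ f y → x ≡ y) where
  open import Data.Nat using (_+_; _*_)
  open ≡ using (refl; cong; sym; trans; subst; module ≡-Reasoning)

  iterate : ℕ → A → A
  iterate zero    x = x
  iterate (suc j) x = f (iterate j x)

  iterate-+ : ∀ i j x → iterate (i + j) x ≡ iterate i (iterate j x)
  iterate-+ zero    j x = refl
  iterate-+ (suc i) j x = cong f (iterate-+ i j x)

  iterate-comm : ∀ i j x → iterate i (iterate j x) ≡ iterate j (iterate i x)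
  iterate-comm i j x = trans (sym (iterate-+ i j x)) (trans (cong (λ k → iterate k x) (ℕ.+-comm i j)) (iterate-+ j i x))

  Reaches : ℕ → A → A → Set a
  Reaches n x y = Any (λ j → iterate j x ≡ y) (upTo n)

  reaches? : ∀ n x y → Dec (Reaches n x y)
  reaches? n x y = any? (λ j → iterate j x ≟ y) (upTo n)

  module _ {n x} (returns : iterate n x ≡ x) where

    reaches-f : ∀ {y} → Reaches n x y → Reaches n x (f y)
    reaches-f r with Any.applyUpTo⁻ id r
    ... | j , j<n , fʲx≡y with ℕ.m≤n⇒m<n∨m≡n j<n
    ...   | inj₁ 1+j<n = Any.applyUpTo⁺ id (cong f fʲx≡y) 1+j<n
    ...   | inj₂ 1+j≡n = Any.applyUpTo⁺ id (trans (sym returns) (trans (cong (λ k → iterate k x) (sym 1+j≡n)) (cong f fʲx≡y)))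
                                        (ℕ.<-≤-trans z<s j<n)

    reaches-f⁻¹ : ∀ {y} → Reaches n x (f y) → Reaches n x y
    reaches-f⁻¹ r with Any.applyUpTo⁻ id r
    ... | suc j , 1+j<n , f¹⁺ʲx≡fy = Any.applyUpTo⁺ id (f-injective f¹⁺ʲx≡fy) (ℕ.<-trans (ℕ.n<1+n j) 1+j<n)
    ... | zero  , 0<n   , x≡fy     =
      Any.applyUpTo⁺ id (f-injective (trans (cong (λ k → iterate k x) 1+pred[n]≡n) (trans returns x≡fy)))
                        (ℕ.≤-reflexive 1+pred[n]≡n)
      where
      1+pred[n]≡n : suc (ℕ.pred n) ≡ n
      1+pred[n]≡n = ℕ.suc-pred n {{ℕ.>-nonZero 0<n}}

  record Period (x : A) : Set a where
    constructor mkPeriod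
    field
      period         : ℕ
      period-pos     : 0 < period
      iterate-period : iterate period x ≡ x
      minimal        : ∀ {j} → 0 < j → j < period → iterate j x ≢ x

  find-period : ∀ {x} n → 0 < n → iterate n x ≡ x → Σ (Period x) λ P → Period.period P ≤ n
  find-period {x} n 0<n fⁿx≡x = search 1 (n ∸ 1) (ℕ.m+[n∸m]≡n 0<n) z<s (λ 0<j j<1 _ → ℕ.<⇒≱ j<1 0<j)
    where
    search : ∀ i r → i + r ≡ n → 0 < i → (∀ {j} → 0 < j → j < i → iterate j x ≢ x) →
             Σ (Period x) λ P → Period.period P ≤ n
    search i r i+r≡n 0<i earlier with iterate i x ≟ x | r
    ... | yes fⁱx≡x | r′     = mkPeriod i 0<i fⁱx≡x earlier , subst (i ≤_) i+r≡n (ℕ.m≤m+n i r′)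
    ... | no  fⁱx≢x | zero   = contradiction (subst (λ k → iterate k x ≡ x) (trans (sym i+r≡n) (ℕ.+-identityʳ i)) fⁿx≡x) fⁱx≢x
    ... | no  fⁱx≢x | suc r′ = search (suc i) r′ (trans (sym (ℕ.+-suc i r′)) i+r≡n) z<s earlier′
      where
      earlier′ : ∀ {j} → 0 < j → j < suc i → iterate j x ≢ x
      earlier′ 0<j j<1+i with ℕ.m<1+n⇒m<n∨m≡n j<1+i
      ... | inj₁ j<i  = earlier 0<j j<i
      ... | inj₂ refl = fⁱx≢x

  module PeriodProperties {x : A} (P : Period x) where
    open Period P public

    instance
      period-nonZero : ℕ.NonZero period
      period-nonZero = ℕ.>-nonZero period-pos

    iterate-multiple : ∀ r t → iterate (r + t * period) x ≡ iterate r x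
    iterate-multiple r zero    = cong (λ k → iterate k x) (ℕ.+-identityʳ r)
    iterate-multiple r (suc t) = begin
      iterate (r + (period + t * period)) x         ≡⟨ cong (λ k → iterate k x) (x∙yz≈y∙xz r period _) ⟩
      iterate (period + (r + t * period)) x         ≡⟨ iterate-+ period _ x ⟩
      iterate period (iterate (r + t * period) x)   ≡⟨ cong (iterate period) (iterate-multiple r t) ⟩
      iterate period (iterate r x)                  ≡⟨ iterate-comm period r x ⟩
      iterate r (iterate period x)                  ≡⟨ cong (iterate r) iterate-period ⟩
      iterate r x                                   ∎
      where open ≡-Reasoning

    iterate-mod : ∀ j → iterate j x ≡ iterate (j % period) x
    iterate-mod j = trans (cong (λ k → iterate k x) (m≡m%n+[m/n]*n j period)) (iterate-multiple (j % period) (j ℕ./ period))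

    iterate-injective : ∀ {i j} → i < period → j < period → iterate i x ≡ iterate j x → i ≡ j
    iterate-injective {zero}  {zero}  _   _   _  = refl
    iterate-injective {zero}  {suc j} _   j<d eq = contradiction (sym eq) (minimal z<s j<d)
    iterate-injective {suc i} {zero}  i<d _   eq = contradiction eq (minimal z<s i<d)
    iterate-injective {suc i} {suc j} i<d j<d eq =
      cong suc (iterate-injective (ℕ.<-trans (ℕ.n<1+n i) i<d) (ℕ.<-trans (ℕ.n<1+n j) j<d) (f-injective eq))

module UniqueLength {a ℓ} (S : Setoid a ℓ) where
  open Setoid S using (_≈_; reflexive; sym; trans) renaming (Carrier to A)
  open import Data.List.Membership.Setoid S using (_∈_)
  open import Data.List.Membership.Setoid.Properties using (∈-lookup)
  open import Data.List.Relation.Unary.Unique.Setoid S using (Unique)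

  lookup-injective : ∀ {xs} → Unique xs → ∀ i j → lookup xs i ≈ lookup xs j → i ≡ j
  lookup-injective (_ ∷ _)        Fin.zero    Fin.zero    _  = ≡.refl
  lookup-injective (x∉xs ∷ _)     Fin.zero    (Fin.suc j) eq = contradiction eq (All.lookup x∉xs (∈ₚ-lookup j))
  lookup-injective (x∉xs ∷ _)     (Fin.suc i) Fin.zero    eq = contradiction (sym eq) (All.lookup x∉xs (∈ₚ-lookup i))
  lookup-injective (_ ∷ distinct) (Fin.suc i) (Fin.suc j) eq = ≡.cong Fin.suc (lookup-injective distinct i j eq)

  unique-length≤ : ∀ {xs d} → Unique xs → (g : Fin d → A) → (∀ {x} → x ∈ xs → Σ (Fin d) λ i → x ≈ g i) →
                   length xs ≤ d
  unique-length≤ {xs} distinct g cover = injective⇒≤ {f = λ i → proj₁ (cover (∈-lookup S xs i))} λ {i} {j} eq →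
    lookup-injective distinct i j
      (trans (proj₂ (cover (∈-lookup S xs i))) (trans (reflexive (≡.cong g eq)) (sym (proj₂ (cover (∈-lookup S xs j))))))

  ≤-length : ∀ {xs d} (g : Fin d → A) → (∀ {i j} → g i ≈ g j → i ≡ j) → (∀ i → g i ∈ xs) → d ≤ length xs
  ≤-length {xs} g g-injective g∈xs = injective⇒≤ {f = λ i → index (g∈xs i)} λ {i} {j} eq →
    g-injective (trans (Any.lookup-index (g∈xs i)) (trans (reflexive (≡.cong (lookup xs) eq)) (sym (Any.lookup-index (g∈xs j)))))

module ReducedPolynomials {c ℓ : Level} (q n : ℕ) (K : FiniteField c ℓ (q ℕ.^ n)) where
  open FiniteField K
  open FFOps q n K
  open import Algebra.Properties.Semiring.Exp semiring using (_^_; ^-congˡ; ^-assocʳ)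
  open import Algebra.Properties.Semiring.Mult semiring using (×1-homo-*) renaming (_×_ to _·_)
  open import Algebra.Properties.Semiring.Sum semiring using (sum; sum-syntax; sum-cong-≋)
  open import Relation.Binary.Reasoning.Setoid setoid

  pow≡^ : ∀ x k → pow x k ≡ x ^ k
  pow≡^ x zero    = ≡.refl
  pow≡^ x (suc k) = ≡.cong (x *_) (pow≡^ x k)

  ΣFin≡sum : ∀ m f → ΣFin m f ≡ sum f
  ΣFin≡sum zero    f = ≡.refl
  ΣFin≡sum (suc m) f = ≡.cong (f Fin.zero +_) (ΣFin≡sum m (f ∘ Fin.suc))

  pow-cong : ∀ {a b} k → a ≈ b → pow a k ≈ pow b k
  pow-cong {a} {b} k a≈b = trans (reflexive (pow≡^ a k)) (trans (^-congˡ k a≈b) (reflexive (≡.sym (pow≡^ b k))))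

  pow-pow : ∀ a s t → pow (pow a s) t ≈ pow a (s ℕ.* t)
  pow-pow a s t = begin
    pow (pow a s) t   ≡⟨ ≡.trans (pow≡^ (pow a s) t) (≡.cong (_^ t) (pow≡^ a s)) ⟩
    (a ^ s) ^ t       ≈⟨ ^-assocʳ a s t ⟩
    a ^ (s ℕ.* t)     ≡⟨ pow≡^ a (s ℕ.* t) ⟨
    pow a (s ℕ.* t)   ∎

  pow-zero : ∀ k → 0 < k → pow 0# k ≈ 0#
  pow-zero (suc k) _ = zeroˡ _

  characteristic : ∀ {p t} → N ≡ p ℕ.^ t → p · 1# ≈ 0#
  characteristic {p} {t} N≡pᵗ with (p · 1#) ≟ 0#
  ... | yes p≈0 = p≈0
  ... | no  p≉0 = contradiction (begin
    pow (p · 1#) t    ≡⟨ pow≡^ (p · 1#) t ⟩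
    (p · 1#) ^ t      ≈⟨ multiple-^ t ⟩
    (p ℕ.^ t) · 1#    ≡⟨ ≡.cong (_· 1#) N≡pᵗ ⟨
    N · 1#            ≈⟨ order-annihilates +-abelianGroup enum enum-inj enum-surj 1# ⟩
    0#                ∎) (powNonzero (p · 1#) t p≉0)
    where
    multiple-^ : ∀ s → (p · 1#) ^ s ≈ (p ℕ.^ s) · 1#
    multiple-^ zero    = sym (+-identityʳ 1#)
    multiple-^ (suc s) = trans (*-congˡ (multiple-^ s)) (sym (×1-homo-* p (p ℕ.^ s)))

  module AsMonoidAlgebra (1<N : 1 < N) where
    open ExponentMonoid 1<N public
    open MonoidAlgebra commutativeSemiring ⊕-isCommutativeMonoid public
    open import Algebra.Properties.Semiring.Exp (CommutativeSemiring.semiring algebra) public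
      using () renaming (_^_ to _^ᴬ_)

    mutual
      *P≈⋆ : ∀ F G → (F *P G) ≈P (F ⋆ G)
      *P≈⋆ F G k = trans (reflexive (ΣFin≡sum N _)) (sum-cong-≋ λ i →
                   trans (reflexive (ΣFin≡sum N _)) (sum-cong-≋ λ j → *P-summand F G k i j))

      -- The summands of `_*P_` are built with a helper local to its definition, which cannot be named here.
      *P-summand : ∀ F G k i j → _ ≈ single (i ⊕ j) (F i * G j) k
      *P-summand F G k i j with redExp N (toℕ i ℕ.+ toℕ j) ℕ.≟ toℕ k
      ... | yes e = sym (≡.subst (λ l → single (i ⊕ j) (F i * G j) l ≈ F i * G j)
                                 (toℕ-injective (≡.trans (toℕ-⊕ i j) e)) (single-self (i ⊕ j) (F i * G j)))
      ... | no ¬e = sym (single-other (F i * G j) (¬e ∘ ≡.trans (≡.sym (toℕ-⊕ i j)) ∘ ≡.cong toℕ))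

    1P≈unit : 1P ≈P unit
    1P≈unit k with toℕ k ℕ.≟ 0
    ... | yes k≡0 = sym (≡.subst (λ l → single 𝟘 1# l ≈ 1#) (toℕ-injective (≡.trans toℕ-𝟘 (≡.sym k≡0)))
                                 (single-self 𝟘 1#))
    ... | no  k≢0 = sym (single-other 1# λ 𝟘≡k → k≢0 (≡.trans (≡.cong toℕ (≡.sym 𝟘≡k)) toℕ-𝟘))

    powP≈^ᴬ : ∀ F m → powP F m ≈P (F ^ᴬ m)
    powP≈^ᴬ F zero    = 1P≈unit
    powP≈^ᴬ F (suc m) k = trans (*P≈⋆ F (powP F m) k) (⋆-cong (λ _ → refl) (powP≈^ᴬ F m) k)

    powP-frobenius : ∀ {p m} → Prime p → q ≡ p ℕ.^ m → 0 < n → ∀ F e → powP F q (q ×ᵢ e) ≈ pow (F e) q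
    powP-frobenius {p} {m} pr q≡pᵐ 0<n F e = begin
      powP F q (q ×ᵢ e)                          ≈⟨ powP≈^ᴬ F q (q ×ᵢ e) ⟩
      (F ^ᴬ q) (q ×ᵢ e)                          ≈⟨ ≡.subst (λ r → (F ^ᴬ r) (r ×ᵢ e) ≈ ∑[ i < N ] single (r ×ᵢ i) (F i ^ r) (r ×ᵢ e))
                                                          (≡.sym q≡pᵐ) (^-char-power pr char m F ((p ℕ.^ m) ×ᵢ e)) ⟩
      ∑[ i < N ] single (q ×ᵢ i) (F i ^ q) (q ×ᵢ e) ≈⟨ sum-single-injective (×ᵢ-injective (m∣m^n 0<n)) (λ i → F i ^ q) e ⟩
      F e ^ q                                    ≡⟨ pow≡^ (F e) q ⟨
      pow (F e) q                                ∎
      where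
      char : p · 1# ≈ 0#
      char = characteristic {p} {m ℕ.* n} (≡.trans (≡.cong (ℕ._^ n) q≡pᵐ) (ℕ.^-*-assoc p m n))

module Orbits {c ℓ : Level} (q n : ℕ) (K : FiniteField c ℓ (q ℕ.^ n)) (1<q : 1 < q) (0<n : 0 < n) where
  open FiniteField K
  open FFOps q n K
  open ReducedPolynomials q n K
  open AsMonoidAlgebra (ℕ.^-monoʳ-< q 1<q 0<n) public

  instance
    q-nonZero : ℕ.NonZero q
    q-nonZero = ℕ.>-nonZero (ℕ.<-trans z<s 1<q)
  open import Relation.Binary.Reasoning.Setoid setoid

  frob : Fin N → Fin N
  frob = q ×ᵢ_

  open Iteration Fin._≟_ frob (×ᵢ-injective (m∣m^n 0<n))

  iterate≡×ᵢ : ∀ j x → iterate j x ≡ (q ℕ.^ j) ×ᵢ x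
  iterate≡×ᵢ zero    x = ≡.sym (×ᵢ-homo-1 x)
  iterate≡×ᵢ (suc j) x = ≡.trans (≡.cong frob (iterate≡×ᵢ j x)) (×ᵢ-assocˡ x q (q ℕ.^ j))

  iterate-returns : ∀ x → iterate n x ≡ x
  iterate-returns x = ≡.trans (iterate≡×ᵢ n x) (N×ᵢ-identity x)

  act-expo : ∀ j {a} x (a≉0 : ¬ a ≈ 0#) → Monomial.expo (act j (mono a (toℕ x) a≉0)) ≡ toℕ (iterate j x)
  act-expo j x _ = ≡.sym (≡.trans (≡.cong toℕ (iterate≡×ᵢ j x)) (toℕ-×ᵢ (q ℕ.^ j) x))

  Invariant : Poly → Set ℓ
  Invariant G = ∀ y → G (frob y) ≈ pow (G y) q

  invariant-iterate : ∀ {G} → Invariant G → ∀ j y → G (iterate j y) ≈ pow (G y) (q ℕ.^ j)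
  invariant-iterate inv zero    y = sym (*-identityʳ _)
  invariant-iterate {G} inv (suc j) y = begin
    G (frob (iterate j y))               ≈⟨ inv (iterate j y) ⟩
    pow (G (iterate j y)) q              ≈⟨ pow-cong q (invariant-iterate inv j y) ⟩
    pow (pow (G y) (q ℕ.^ j)) q          ≈⟨ pow-pow (G y) (q ℕ.^ j) q ⟩
    pow (G y) (q ℕ.^ j ℕ.* q)            ≡⟨ ≡.cong (pow (G y)) (ℕ.*-comm (q ℕ.^ j) q) ⟩
    pow (G y) (q ℕ.^ suc j)              ∎

  ≈M-decSetoid : DecSetoid (c ⊔ ℓ) ℓ
  ≈M-decSetoid = record
    { Carrier = Monomial
    ; _≈_ = _≈M_
    ; isDecEquivalence = record
      { isEquivalence = record
        { refl  = refl , ≡.refl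
        ; sym   = λ (a≈b , e≡e′) → sym a≈b , ≡.sym e≡e′
        ; trans = λ (a≈b , e≡e′) (b≈c , e′≡e″) → trans a≈b b≈c , ≡.trans e≡e′ e′≡e″ }
      ; _≟_ = _≟M_ } }

  open DecSetoid ≈M-decSetoid using () renaming (setoid to ≈M-setoid)
  open import Data.List.Relation.Unary.Unique.Setoid ≈M-setoid using (Unique)
  open UniqueLength ≈M-setoid

  monomialOf-≈M : ∀ {G} o o′ → MonomialOf G o → MonomialOf G o′ → Monomial.expo o ≡ Monomial.expo o′ → o ≈M o′
  monomialOf-≈M {G} _ _ (k , k≡e , a≈Gk) (k′ , k′≡e′ , a′≈Gk′) e≡e′ =
    trans a≈Gk (trans (reflexive (≡.cong G k≡k′)) (sym a′≈Gk′)) , e≡e′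
    where
    k≡k′ : k ≡ k′
    k≡k′ = toℕ-injective (≡.trans k≡e (≡.trans e≡e′ (≡.sym k′≡e′)))

  orbit-unique : ∀ m → Unique (orbit m)
  orbit-unique m = deduplicate-! ≈M-decSetoid _

  any-orbit⁻ : ∀ {p} {P : Monomial → Set p} m → Any P (orbit m) → Σ ℕ λ j → j < n × P (act j m)
  any-orbit⁻ m p = Any.applyUpTo⁻ id (Any.map⁻ (Any.deduplicate⁻ _≟M_ p))

  any-orbit⁺ : ∀ {p} {P : Monomial → Set p} m → (∀ {o o′} → o′ ≈M o → P o → P o′) →
               ∀ {j} → j < n → P (act j m) → Any P (orbit m)
  any-orbit⁺ m resp j<n p = Any.deduplicate⁺ _≟M_ resp (Any.map⁺ (Any.applyUpTo⁺ id p j<n))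

  monoPoly-at : ∀ o k → toℕ k ≡ Monomial.expo o → monoPoly o k ≈ Monomial.coef o
  monoPoly-at o k k≡e with toℕ k ℕ.≟ Monomial.expo o
  ... | yes _   = refl
  ... | no  k≢e = contradiction k≡e k≢e

  monoPoly-off : ∀ o k → toℕ k ≢ Monomial.expo o → monoPoly o k ≈ 0#
  monoPoly-off o k k≢e with toℕ k ℕ.≟ Monomial.expo o
  ... | yes k≡e = contradiction k≡e k≢e
  ... | no  _   = refl

  HasExponent : Fin N → Monomial → Set
  HasExponent k o = Monomial.expo o ≡ toℕ k

  sum-monomials-off : ∀ os k → ¬ Any (HasExponent k) os → sumP (map monoPoly os) k ≈ 0#
  sum-monomials-off []       k _    = refl
  sum-monomials-off (o ∷ os) k ¬any = trans (+-cong (monoPoly-off o k (¬any ∘ here ∘ ≡.sym))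
                                                    (sum-monomials-off os k (¬any ∘ there)))
                                            (+-identityʳ 0#)

  exponent-unrepeated : ∀ {G} o {os} k → MonomialOf G o → All (λ o′ → ¬ o ≈M o′) os → All (MonomialOf G) os →
                        Any (HasExponent k) os → Monomial.expo o ≢ toℕ k
  exponent-unrepeated {G} o {o′ ∷ _} k o∈G (o≉o′ ∷ _) (o′∈G ∷ _) (here e′≡k) e≡k =
    o≉o′ (monomialOf-≈M {G} o o′ o∈G o′∈G (≡.trans e≡k (≡.sym e′≡k)))
  exponent-unrepeated {G} o k o∈G (_ ∷ o∉os) (_ ∷ os∈G) (there a) = exponent-unrepeated {G} o k o∈G o∉os os∈G a

  sum-monomials-at : ∀ {G} os → Unique os → All (MonomialOf G) os → ∀ k → Any (HasExponent k) os →
                     sumP (map monoPoly os) k ≈ G k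
  sum-monomials-at {G} (o ∷ os) (o∉os ∷ _) (o∈G ∷ os∈G) k (here e≡k) = begin
    monoPoly o k + sumP (map monoPoly os) k  ≈⟨ +-cong (monoPoly-at o k (≡.sym e≡k)) (sum-monomials-off os k clash) ⟩
    Monomial.coef o + 0#                     ≈⟨ +-identityʳ _ ⟩
    Monomial.coef o                          ≈⟨ coef≈G o∈G ⟩
    G k                                      ∎
    where
    coef≈G : MonomialOf G o → Monomial.coef o ≈ G k
    coef≈G (k′ , k′≡e , a≈Gk′) = trans a≈Gk′ (reflexive (≡.cong G (toℕ-injective (≡.trans k′≡e e≡k))))
    clash : ¬ Any (HasExponent k) os
    clash a = exponent-unrepeated {G} o k o∈G o∉os os∈G a e≡k
  sum-monomials-at {G} (o ∷ os) (o∉os ∷ u) (o∈G ∷ os∈G) k (there a) = begin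
    monoPoly o k + sumP (map monoPoly os) k  ≈⟨ +-cong (monoPoly-off o k clash) (sum-monomials-at os u os∈G k a) ⟩
    0# + G k                                 ≈⟨ +-identityˡ _ ⟩
    G k                                      ∎
    where
    clash : toℕ k ≢ Monomial.expo o
    clash k≡e = exponent-unrepeated {G} o k o∈G o∉os os∈G a (≡.sym k≡e)

  Decomposition : Poly → Poly → Set (c ⊔ ℓ)
  Decomposition F G = Σ (List Monomial) λ ms →
    All (MonomialOf F) ms × (G ≈P sumP (map orbitSum ms)) × All (λ m → DefinedOver (s m) (orbitSum m)) ms

  Restricts : Poly → Poly → Set ℓ
  Restricts F G = ∀ k → G k ≈ 0# ⊎ G k ≈ F k

  module Orbit (G : Poly) (inv : Invariant G) (x : Fin N) (Gx≉0 : ¬ G x ≈ 0#) where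

    m : Monomial
    m = mono (G x) (toℕ x) Gx≉0

    act-monomialOf : ∀ j → MonomialOf G (act j m)
    act-monomialOf j = iterate j x , ≡.sym (act-expo j x Gx≉0) , sym (invariant-iterate inv j x)

    orbit-monomialsOf : All (MonomialOf G) (orbit m)
    orbit-monomialsOf = All.deduplicate⁺ _≟M_ (All.map⁺ (All.applyUpTo⁺₁ id n (λ {j} _ → act-monomialOf j)))

    orbit-hasExponent⇒reaches : ∀ k → Any (HasExponent k) (orbit m) → Reaches n x k
    orbit-hasExponent⇒reaches k a with any-orbit⁻ m a
    ... | j , j<n , e≡k = Any.applyUpTo⁺ id (toℕ-injective (≡.trans (≡.sym (act-expo j x Gx≉0)) e≡k)) j<n

    reaches⇒orbit-hasExponent : ∀ k → Reaches n x k → Any (HasExponent k) (orbit m)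
    reaches⇒orbit-hasExponent k r with Any.applyUpTo⁻ id r
    ... | j , j<n , fʲx≡k = any-orbit⁺ m (λ (_ , e′≡e) e≡k → ≡.trans e′≡e e≡k) j<n
                                        (≡.trans (act-expo j x Gx≉0) (≡.cong toℕ fʲx≡k))

    orbitSum-reached : ∀ k → Reaches n x k → orbitSum m k ≈ G k
    orbitSum-reached k r = sum-monomials-at (orbit m) (orbit-unique m) orbit-monomialsOf k (reaches⇒orbit-hasExponent k r)

    orbitSum-unreached : ∀ k → ¬ Reaches n x k → orbitSum m k ≈ 0#
    orbitSum-unreached k ¬r = sum-monomials-off (orbit m) k (¬r ∘ orbit-hasExponent⇒reaches k)

    x-period : Σ (Period x) λ P → Period.period P ≤ n
    x-period = find-period n 0<n (iterate-returns x)

    open PeriodProperties (proj₁ x-period)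

    s≡period : s m ≡ period
    -- `cover` is η-expanded because `_≈M_` does not determine its implicit argument.
    s≡period = ℕ.≤-antisym (unique-length≤ (orbit-unique m) g (λ {o} → cover {o})) (≤-length g g-injective g∈orbit)
      where
      g : Fin period → Monomial
      g i = act (toℕ i) m
      act-≈M : ∀ i j → iterate i x ≡ iterate j x → act i m ≈M act j m
      act-≈M i j eq = monomialOf-≈M (act i m) (act j m) (act-monomialOf i) (act-monomialOf j)
        (≡.trans (act-expo i x Gx≉0) (≡.trans (≡.cong toℕ eq) (≡.sym (act-expo j x Gx≉0))))
      cover : ∀ {o} → Any (o ≈M_) (orbit m) → Σ (Fin period) λ i → o ≈M g i
      cover {o} o∈orbit with any-orbit⁻ m o∈orbit
      ... | j , _ , (a≈b , e≡e′) with act-≈M j (toℕ (fromℕ< (m%n<n j period)))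
                                      (≡.trans (iterate-mod j) (≡.cong (λ i → iterate i x) (≡.sym (toℕ-fromℕ< (m%n<n j period)))))
      ...   | b≈c , e′≡e″ = fromℕ< (m%n<n j period) , trans a≈b b≈c , ≡.trans e≡e′ e′≡e″
      g-injective : ∀ {i j} → g i ≈M g j → i ≡ j
      g-injective {i} {j} (_ , e≡e′) = toℕ-injective (iterate-injective (toℕ<n i) (toℕ<n j)
        (toℕ-injective (≡.trans (≡.sym (act-expo (toℕ i) x Gx≉0)) (≡.trans e≡e′ (act-expo (toℕ j) x Gx≉0)))))
      g∈orbit : ∀ i → Any (g i ≈M_) (orbit m)
      g∈orbit i = any-orbit⁺ m (λ (b≈a , e′≡e) (c≈a , e″≡e) → trans c≈a (sym b≈a) , ≡.trans e″≡e (≡.sym e′≡e))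
                             (ℕ.<-≤-trans (toℕ<n i) (proj₂ x-period)) (refl , ≡.refl)

    orbitSum-definedOver : DefinedOver (s m) (orbitSum m)
    orbitSum-definedOver = ≡.subst (λ t → DefinedOver t (orbitSum m)) (≡.sym s≡period) definedOver-period
      where
      definedOver-period : DefinedOver period (orbitSum m)
      definedOver-period k with reaches? n x k
      ... | yes r = begin
        pow (orbitSum m k) (q ℕ.^ period)  ≈⟨ pow-cong (q ℕ.^ period) (orbitSum-reached k r) ⟩
        pow (G k) (q ℕ.^ period)           ≈⟨ invariant-iterate inv period k ⟨
        G (iterate period k)               ≡⟨ ≡.cong G (period-fixes r) ⟩
        G k                                ≈⟨ orbitSum-reached k r ⟨
        orbitSum m k                       ∎
        where
        period-fixes : ∀ {y} → Reaches n x y → iterate period y ≡ y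
        period-fixes r with Any.applyUpTo⁻ id r
        ... | j , _ , ≡.refl = ≡.trans (iterate-comm period j x) (≡.cong (iterate j) iterate-period)
      ... | no ¬r = begin
        pow (orbitSum m k) (q ℕ.^ period)  ≈⟨ pow-cong (q ℕ.^ period) (orbitSum-unreached k ¬r) ⟩
        pow 0# (q ℕ.^ period)              ≈⟨ pow-zero (q ℕ.^ period) (ℕ.m^n>0 q period) ⟩
        0#                                 ≈⟨ orbitSum-unreached k ¬r ⟨
        orbitSum m k                       ∎

    remainder : Poly
    remainder k with reaches? n x k
    ... | yes _ = 0#
    ... | no  _ = G k

    remainder-reached : ∀ {k} → Reaches n x k → remainder k ≈ 0#
    remainder-reached {k} r with reaches? n x k
    ... | yes _ = refl
    ... | no ¬r = contradiction r ¬r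

    remainder-unreached : ∀ {k} → ¬ Reaches n x k → remainder k ≈ G k
    remainder-unreached {k} ¬r with reaches? n x k
    ... | yes r = contradiction r ¬r
    ... | no  _ = refl

    split : G ≈P (orbitSum m +P remainder)
    split k = split-at (reaches? n x k)
      where
      split-at : Dec (Reaches n x k) → G k ≈ orbitSum m k + remainder k
      split-at (yes r) = sym (trans (+-cong (orbitSum-reached k r) (remainder-reached r)) (+-identityʳ _))
      split-at (no ¬r) = sym (trans (+-cong (orbitSum-unreached k ¬r) (remainder-unreached ¬r)) (+-identityˡ _))

    remainder-invariant : Invariant remainder
    remainder-invariant y = invariant-at (reaches? n x y)
      where
      invariant-at : Dec (Reaches n x y) → remainder (frob y) ≈ pow (remainder y) q
      invariant-at (yes r) = trans (remainder-reached (reaches-f (iterate-returns x) r))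
                                   (sym (trans (pow-cong q (remainder-reached r)) (pow-zero q (ℕ.<-trans z<s 1<q))))
      invariant-at (no ¬r) = trans (remainder-unreached (¬r ∘ reaches-f⁻¹ (iterate-returns x)))
                                   (trans (inv y) (pow-cong q (sym (remainder-unreached ¬r))))

    private
      remainder-vanishes-or-agrees : ∀ k → remainder k ≈ 0# ⊎ remainder k ≈ G k
      remainder-vanishes-or-agrees k with reaches? n x k
      ... | yes _ = inj₁ refl
      ... | no  _ = inj₂ refl

    remainder-restricts : ∀ {F} → Restricts F G → Restricts F remainder
    remainder-restricts G⊑F k with remainder-vanishes-or-agrees k | G⊑F k
    ... | inj₁ r≈0 | _        = inj₁ r≈0
    ... | inj₂ r≈G | inj₁ G≈0 = inj₁ (trans r≈G G≈0)
    ... | inj₂ r≈G | inj₂ G≈F = inj₂ (trans r≈G G≈F)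

    remainder-supported : ∀ {xs} → (∀ k → k ∉ xs → G k ≈ 0#) → ∀ k → k ∉ xs → remainder k ≈ 0#
    remainder-supported supported k k∉xs with remainder-vanishes-or-agrees k
    ... | inj₁ r≈0 = r≈0
    ... | inj₂ r≈G = trans r≈G (supported k k∉xs)

    x-reached : Reaches n x x
    x-reached = Any.applyUpTo⁺ id ≡.refl 0<n

    add-orbit : ∀ {F} → MonomialOf F m → Decomposition F remainder → Decomposition F G
    add-orbit m∈F (ms , ms∈F , remainder≈ , definedOvers) =
      m ∷ ms , m∈F ∷ ms∈F , (λ k → trans (split k) (+-congˡ (remainder≈ k))) , orbitSum-definedOver ∷ definedOvers

  supported-tail : ∀ {H : Poly} {y ys} → H y ≈ 0# → (∀ k → k ∉ y ∷ ys → H k ≈ 0#) →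
                   ∀ k → k ∉ ys → H k ≈ 0#
  supported-tail {y = y} Hy≈0 supported k k∉ys with k Fin.≟ y
  ... | yes ≡.refl = Hy≈0
  ... | no  k≢y    = supported k λ { (here k≡y) → k≢y k≡y ; (there k∈ys) → k∉ys k∈ys }

  peel : ∀ F xs G → Invariant G → Restricts F G → (∀ k → k ∉ xs → G k ≈ 0#) → Decomposition F G
  peel F []       G inv G⊑F supported = [] , [] , (λ k → supported k λ ()) , []
  peel F (y ∷ ys) G inv G⊑F supported with G y ≟ 0# | G⊑F y
  ... | yes Gy≈0 | _          = peel F ys G inv G⊑F (supported-tail Gy≈0 supported)
  ... | no  Gy≉0 | inj₁ Gy≈0  = contradiction Gy≈0 Gy≉0
  ... | no  Gy≉0 | inj₂ Gy≈Fy = add-orbit (y , ≡.refl , Gy≈Fy)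
    (peel F ys remainder remainder-invariant (remainder-restricts G⊑F)
          (supported-tail (remainder-reached x-reached) (remainder-supported supported)))
    where open Orbit G inv y Gy≉0

  invariant-decomposition : ∀ F → Invariant F → Decomposition F F
  invariant-decomposition F inv = peel F (allFin N) F inv (λ _ → inj₂ refl) (λ k k∉ → contradiction (∈-allFin k) k∉)

prime-power>1 : ∀ {p e} → Prime p → 1 < p ℕ.^ suc e
prime-power>1 {p} {e} pr = ℕ.<-≤-trans (ℕ.nonTrivial⇒n>1 p {{prime⇒nonTrivial pr}})
                                       (ℕ.m≤m*n p (p ℕ.^ e) {{ℕ.m^n≢0 p e {{prime⇒nonZero pr}}}})

proposition4p4 : ∀ {c ℓ : Level} (q n : ℕ) → IsPrimePower q → 1 ≤ n →
    (K : FiniteField c ℓ (Data.Nat._^_ q n)) →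
    let open FFOps q n K in
    (F : Poly) → powP F q ≈P F →
    Σ (List Monomial) λ ms →
      All (MonomialOf F) ms ×
      (F ≈P sumP (map orbitSum ms)) ×
      All (λ m → DefinedOver (s m) (orbitSum m)) ms
proposition4p4 q n (p , e , pr , q≡pᵉ) 0<n K F Fᵠ≈F = invariant-decomposition F F-invariant
  where
  open FiniteField K
  open Orbits q n K (≡.subst (1 <_) (≡.sym q≡pᵉ) (prime-power>1 {e = e} pr)) 0<n
  F-invariant : Invariant F
  F-invariant y = trans (sym (Fᵠ≈F (q ×ᵢ y))) (powP-frobenius {m = suc e} pr q≡pᵉ 0<n F y)
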